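{- (1) The maximum size of a cap in $\mathrm{AG}(7,2)=\mathbb{Z}_2^7$ is $12$. (2) Every complete cap of dimension $7$ has size $12$.
   Context: Work in $\mathbb{Z}_2^n$. The affine span $\operatorname{aff}(S)$ of a subset $S$ is the set of all sums of an odd number of distinct elements of $S$; the dimension of $S$ is the dimension of the affine flat $\operatorname{aff}(S)$. A quad is a set of four distinct elements summing to $\mathbf{0}$; a cap is a quad-free subset. A cap $C$ is complete if it is a maximal quad-free subset of $\operatorname{aff}(C)$. -}

module Defs where

open import Data.Bool using (Bool; true; false; _xor_)
open import Data.Bool.Properties using () renaming (_≟_ to _≟B_)
open import Data.Nat using (ℕ; zero; suc; _^_)
open import Data.List using (List; []; _∷_; map; _++_; length; filter; foldr)
open import Data.List.Relation.Unary.Any using (any?)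
open import Data.List.Membership.Propositional using (_∈_)
open import Data.List.Relation.Unary.All using (All)
open import Data.List.Relation.Unary.Unique.Propositional using (Unique)
open import Data.Vec using (Vec; []; _∷_; replicate; zipWith)
open import Data.Vec.Properties using (≡-dec)
open import Data.Product using (Σ; ∃; _×_; _,_)
open import Relation.Nullary using (¬_; Dec)
open import Relation.Binary.PropositionalEquality using (_≡_; _≢_)

Point : ℕ → Set
Point n = Vec Bool n

_⊕_ : ∀ {n} → Point n → Point n → Point n
_⊕_ = zipWith _xor_

𝟎 : ∀ {n} → Point n
𝟎 = replicate _ false

_≟P_ : ∀ {n} (x y : Point n) → Dec (x ≡ y)
_≟P_ = ≡-dec _≟B_

sumP : ∀ {n} → List (Point n) → Point n
sumP = foldr _⊕_ 𝟎

allPoints : (n : ℕ) → List (Point n)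
allPoints zero = [] ∷ []
allPoints (suc n) = map (false ∷_) (allPoints n) ++ map (true ∷_) (allPoints n)

-- Subsets of a finite set (given as a duplicate-free list) are represented
-- by duplicate-free lists.  Sub-selections of a list: all sublists.
sublists : ∀ {a} {A : Set a} → List A → List (List A)
sublists [] = [] ∷ []
sublists (x ∷ xs) = sublists xs ++ map (x ∷_) (sublists xs)

isOdd : ℕ → Bool
isOdd zero = false
isOdd (suc k) with isOdd k
... | true = false
... | false = true

-- The affine span: all sums of an odd number of distinct elements of S
-- (for duplicate-free S, sublists of S are exactly subsets of distinct elements).
aff : ∀ {n} → List (Point n) → List (Point n)
aff S = map sumP (filter (λ T → isOdd (length T) ≟B true) (sublists S))

affCard : ∀ {n} → List (Point n) → ℕ
affCard {n} S = length (filter (λ x → any? (x ≟P_) (aff S)) (allPoints n))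

HasDim : ∀ {n} → List (Point n) → ℕ → Set
HasDim S d = affCard S ≡ 2 ^ d

HasQuad : ∀ {n} → List (Point n) → Set
HasQuad {n} S = Σ (Point n) λ a → Σ (Point n) λ b → Σ (Point n) λ c → Σ (Point n) λ d →
  (a ∈ S) × (b ∈ S) × (c ∈ S) × (d ∈ S) ×
  (a ≢ b) × (a ≢ c) × (a ≢ d) × (b ≢ c) × (b ≢ d) × (c ≢ d) ×
  (a ⊕ (b ⊕ (c ⊕ d)) ≡ 𝟎)

IsCap : ∀ {n} → List (Point n) → Set
IsCap S = Unique S × ¬ HasQuad S

IsCompleteCap : ∀ {n} → List (Point n) → Set
IsCompleteCap {n} C = IsCap C ×
  ((D : List (Point n)) → IsCap D → All (_∈ aff C) D → All (_∈ D) C → All (_∈ C) D)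

{-# OPTIONS --safe #-}
module Submission where

-- Every cap C spans an affine frame made of its own points, so in the affine coordinates
-- of aff(C) it becomes a cap in Z_2^k containing 0 and the k unit vectors, where k is the
-- dimension of C. For k = 7 an exhaustive depth-first search over such caps shows that
-- each has at most 12 points and that each with fewer points has a point that can be
-- added without creating a quad; the search keeps, as a bit trie, the set of points that
-- are in the cap or are sums of three of its points, which are exactly the points whose
-- addition creates a quad. A cap of dimension k < 7 is reduced to dimension k + 1 by
-- adding a unit vector in a new coordinate, which cannot lie in a quad.

open import Defs
open import Algebra.Bundles using (CommutativeRing; CommutativeSemigroup)
import Algebra.Properties.CommutativeSemigroup as CommutativeSemigroupProperties
open import Data.Bool using (Bool; true; false; _∧_; _∨_; not; if_then_else_; _xor_)
open import Data.Bool.Properties using (xor-assoc; xor-comm; xor-identityˡ; xor-identityʳ; xor-same; xor-∧-commutativeRing; T-≡)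
  renaming (_≟_ to _≟B_)
open import Data.Nat using (ℕ; zero; suc; _+_; _≤_; _<_; _^_; _≤ᵇ_; _<ᵇ_; z≤n; s≤s; _≤′_; ≤′-refl; ≤′-step)
open import Data.Nat.Properties
  using ( ≤-trans; ≤-reflexive; ≤-antisym; ≤-<-trans; ≤ᵇ⇒≤; <⇒<ᵇ; ≮⇒≥; <⇒≱; ≰⇒>; _≤?_; n≤1+n
        ; +-identityʳ; ^-monoʳ-<; ≤⇒≤′; module ≤-Reasoning)
open import Data.List using (List; []; _∷_; map; _++_; length; filter; foldr)
open import Data.List.Properties using (length-++; length-map; filter-notAll; filter-none)
open import Data.List.Relation.Unary.Any using (Any; here; there; any?; satisfied)
open import Data.List.Relation.Unary.All as All using (All; []; _∷_)
open import Data.List.Relation.Unary.All.Properties using (¬Any⇒All¬; All¬⇒¬Any)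
open import Data.List.Relation.Unary.AllPairs using ([]; _∷_)
open import Data.List.Relation.Unary.Unique.Propositional using (Unique)
import Data.List.Relation.Unary.Unique.Propositional.Properties as Unique
import Data.List.Relation.Unary.Unique.DecPropositional as UniqueDec
open import Data.List.Membership.Propositional using (_∈_; _∉_; lose)
import Data.List.Membership.DecPropositional as DecMembership
open import Data.List.Membership.Propositional.Properties
  using (∈-map⁺; ∈-map⁻; ∈-++⁺ˡ; ∈-++⁺ʳ; ∈-++⁻; ∈-filter⁺; ∈-filter⁻)
open import Data.List.Relation.Binary.Subset.Propositional using (_⊆_)
open import Data.List.Relation.Binary.Sublist.Propositional using ([]; _∷ʳ_; _∷_) renaming (_⊆_ to _⊑_)
open import Data.List.Relation.Binary.Sublist.Propositional.Properties using (filter-⊆)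
open import Data.List.Relation.Binary.Disjoint.Propositional using (Disjoint)
open import Data.Vec using (Vec; []; _∷_; fromList)
open import Data.Vec.Properties using (zipWith-assoc; zipWith-comm; zipWith-identityˡ; zipWith-identityʳ; ∷-injectiveʳ)
open import Data.Product using (Σ; ∃; _×_; _,_; proj₁; proj₂)
open import Data.Sum using (_⊎_; inj₁; inj₂)
open import Function using (_∘_; id)
open import Function.Bundles using (Equivalence)
open import Function.Definitions using (Injective)
open import Level using (0ℓ)
open import Relation.Nullary using (¬_; Dec; yes; no; ¬?; contradiction)
open import Relation.Nullary.Decidable using (_×-dec_; toWitness)
open import Relation.Binary.PropositionalEquality
  using (_≡_; _≢_; refl; sym; trans; cong; cong₂; subst; isEquivalence; module ≡-Reasoning)

private
  variable
    k n : ℕ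

-- The group Z_2^n

⊕-assoc : (x y z : Point n) → (x ⊕ y) ⊕ z ≡ x ⊕ (y ⊕ z)
⊕-assoc = zipWith-assoc xor-assoc

⊕-comm : (x y : Point n) → x ⊕ y ≡ y ⊕ x
⊕-comm = zipWith-comm xor-comm

⊕-identityˡ : (x : Point n) → 𝟎 ⊕ x ≡ x
⊕-identityˡ = zipWith-identityˡ xor-identityˡ

⊕-identityʳ : (x : Point n) → x ⊕ 𝟎 ≡ x
⊕-identityʳ = zipWith-identityʳ xor-identityʳ

⊕-self : (x : Point n) → x ⊕ x ≡ 𝟎
⊕-self []      = refl
⊕-self (b ∷ x) = cong₂ _∷_ (xor-same b) (⊕-self x)

⊕-commutativeSemigroup : ℕ → CommutativeSemigroup 0ℓ 0ℓ
⊕-commutativeSemigroup n = record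
  { Carrier = Point n
  ; _≈_     = _≡_
  ; _∙_     = _⊕_
  ; isCommutativeSemigroup = record
    { isSemigroup = record
      { isMagma = record { isEquivalence = isEquivalence ; ∙-cong = cong₂ _⊕_ }
      ; assoc   = ⊕-assoc
      }
    ; comm = ⊕-comm
    }
  }

open module ⊕-Properties {n} = CommutativeSemigroupProperties (⊕-commutativeSemigroup n)
  using (interchange; x∙yz≈y∙xz; x∙yz≈z∙xy)

open CommutativeSemigroupProperties (CommutativeRing.+-commutativeSemigroup xor-∧-commutativeRing)
  using () renaming (interchange to xor-interchange)

⊕-cancelˡ : (x y : Point n) → x ⊕ (x ⊕ y) ≡ y
⊕-cancelˡ x y = begin
  x ⊕ (x ⊕ y)  ≡⟨ ⊕-assoc x x y ⟨
  (x ⊕ x) ⊕ y  ≡⟨ cong (_⊕ y) (⊕-self x) ⟩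
  𝟎 ⊕ y        ≡⟨ ⊕-identityˡ y ⟩
  y            ∎
  where open ≡-Reasoning

⊕-cancel-common : (b x y : Point n) → (b ⊕ x) ⊕ (b ⊕ y) ≡ x ⊕ y
⊕-cancel-common b x y = begin
  (b ⊕ x) ⊕ (b ⊕ y)  ≡⟨ interchange b x b y ⟩
  (b ⊕ b) ⊕ (x ⊕ y)  ≡⟨ cong (_⊕ (x ⊕ y)) (⊕-self b) ⟩
  𝟎 ⊕ (x ⊕ y)        ≡⟨ ⊕-identityˡ (x ⊕ y) ⟩
  x ⊕ y              ∎
  where open ≡-Reasoning

⊕≡𝟎⇒≡ : {x y : Point n} → x ⊕ y ≡ 𝟎 → x ≡ y
⊕≡𝟎⇒≡ {x = x} {y} x⊕y≡𝟎 = begin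
  x            ≡⟨ ⊕-identityʳ x ⟨
  x ⊕ 𝟎        ≡⟨ cong (x ⊕_) x⊕y≡𝟎 ⟨
  x ⊕ (x ⊕ y)  ≡⟨ ⊕-cancelˡ x y ⟩
  y            ∎
  where open ≡-Reasoning

≡⇒⊕≡𝟎 : {x y : Point n} → x ≡ y → x ⊕ y ≡ 𝟎
≡⇒⊕≡𝟎 {x = x} refl = ⊕-self x

sum₄ : Point n → Point n → Point n → Point n → Point n
sum₄ a b c d = a ⊕ (b ⊕ (c ⊕ d))

quad-sum₁ : {a b c d : Point n} → sum₄ a b c d ≡ 𝟎 → a ≡ b ⊕ (c ⊕ d)
quad-sum₁ = ⊕≡𝟎⇒≡

quad-sum₂ : {a b c d : Point n} → sum₄ a b c d ≡ 𝟎 → b ≡ a ⊕ (c ⊕ d)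
quad-sum₂ {a = a} {b} {c} {d} sum = ⊕≡𝟎⇒≡ (trans (x∙yz≈y∙xz b a (c ⊕ d)) sum)

quad-sum₃ : {a b c d : Point n} → sum₄ a b c d ≡ 𝟎 → c ≡ a ⊕ (b ⊕ d)
quad-sum₃ {a = a} {b} {c} {d} sum =
  ⊕≡𝟎⇒≡ (trans (x∙yz≈y∙xz c a (b ⊕ d)) (trans (cong (a ⊕_) (x∙yz≈y∙xz c b d)) sum))

quad-sum₄ : {a b c d : Point n} → sum₄ a b c d ≡ 𝟎 → d ≡ a ⊕ (b ⊕ c)
quad-sum₄ {a = a} {b} {c} {d} sum = ⊕≡𝟎⇒≡ (begin
  d ⊕ (a ⊕ (b ⊕ c))  ≡⟨ x∙yz≈y∙xz d a (b ⊕ c) ⟩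
  a ⊕ (d ⊕ (b ⊕ c))  ≡⟨ cong (a ⊕_) (x∙yz≈y∙xz d b c) ⟩
  a ⊕ (b ⊕ (d ⊕ c))  ≡⟨ cong (λ z → a ⊕ (b ⊕ z)) (⊕-comm d c) ⟩
  a ⊕ (b ⊕ (c ⊕ d))  ≡⟨ sum ⟩
  𝟎                  ∎)
  where open ≡-Reasoning

_∈?_ : (x : Point n) (xs : List (Point n)) → Dec (x ∈ xs)
_∈?_ = DecMembership._∈?_ _≟P_

∈-allPoints : (x : Point n) → x ∈ allPoints n
∈-allPoints []            = here refl
∈-allPoints (false ∷ x)   = ∈-++⁺ˡ (∈-map⁺ (false ∷_) (∈-allPoints x))
∈-allPoints {suc n} (true ∷ x) = ∈-++⁺ʳ (map (false ∷_) (allPoints n)) (∈-map⁺ (true ∷_) (∈-allPoints x))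

allPoints-unique : (n : ℕ) → Unique (allPoints n)
allPoints-unique zero    = [] ∷ []
allPoints-unique (suc n) =
  Unique.++⁺ (Unique.map⁺ ∷-injectiveʳ (allPoints-unique n)) (Unique.map⁺ ∷-injectiveʳ (allPoints-unique n)) halves-disjoint
  where
  halves-disjoint : Disjoint (map (false ∷_) (allPoints n)) (map (true ∷_) (allPoints n))
  halves-disjoint (m₁ , m₂) with ∈-map⁻ (false ∷_) m₁ | ∈-map⁻ (true ∷_) m₂
  ... | _ , _ , refl | _ , _ , ()

length-allPoints : (n : ℕ) → length (allPoints n) ≡ 2 ^ n
length-allPoints zero    = refl
length-allPoints (suc n) = begin
  length (map (false ∷_) (allPoints n) ++ map (true ∷_) (allPoints n))
    ≡⟨ length-++ (map (false ∷_) (allPoints n)) ⟩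
  length (map (false ∷_) (allPoints n)) + length (map (true ∷_) (allPoints n))
    ≡⟨ cong₂ _+_ (length-map (false ∷_) (allPoints n)) (length-map (true ∷_) (allPoints n)) ⟩
  length (allPoints n) + length (allPoints n)
    ≡⟨ cong₂ _+_ (length-allPoints n) (length-allPoints n) ⟩
  2 ^ n + 2 ^ n
    ≡⟨ cong (2 ^ n +_) (+-identityʳ (2 ^ n)) ⟨
  2 ^ suc n ∎
  where open ≡-Reasoning

Unique-⊆⇒length≤ : {xs ys : List (Point n)} → Unique xs → xs ⊆ ys → length xs ≤ length ys
Unique-⊆⇒length≤ {xs = []}     _                 _        = z≤n
Unique-⊆⇒length≤ {xs = x ∷ xs} {ys} (x∉xs ∷ unique) x∷xs⊆ys =
  ≤-trans (s≤s (Unique-⊆⇒length≤ unique xs⊆others)) (filter-notAll others? ys x∉others)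
  where
  others? : (y : Point _) → Dec (x ≢ y)
  others? y = ¬? (x ≟P y)
  xs⊆others : xs ⊆ filter others? ys
  xs⊆others y∈xs = ∈-filter⁺ others? (x∷xs⊆ys (there y∈xs)) (λ { refl → All¬⇒¬Any x∉xs y∈xs })
  x∉others : Any (λ y → ¬ (x ≢ y)) ys
  x∉others = lose (x∷xs⊆ys (here refl)) (λ x≢x → x≢x refl)

Unique-⊆-length≡ : {xs ys : List (Point n)} → Unique xs → Unique ys → xs ⊆ ys → ys ⊆ xs → length xs ≡ length ys
Unique-⊆-length≡ uxs uys xs⊆ys ys⊆xs = ≤-antisym (Unique-⊆⇒length≤ uxs xs⊆ys) (Unique-⊆⇒length≤ uys ys⊆xs)

2^m≤2^n⇒m≤n : {m n : ℕ} → 2 ^ m ≤ 2 ^ n → m ≤ n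
2^m≤2^n⇒m≤n {m} {n} 2^m≤2^n with m ≤? n
... | yes m≤n = m≤n
... | no  m≰n = contradiction 2^m≤2^n (<⇒≱ (^-monoʳ-< 2 (s≤s (s≤s z≤n)) (≰⇒> m≰n)))

2^m≡2^n⇒m≡n : {m n : ℕ} → 2 ^ m ≡ 2 ^ n → m ≡ n
2^m≡2^n⇒m≡n eq = ≤-antisym (2^m≤2^n⇒m≤n (≤-reflexive eq)) (2^m≤2^n⇒m≤n (≤-reflexive (sym eq)))

units : (n : ℕ) → List (Point n)
units zero    = []
units (suc n) = (true ∷ 𝟎) ∷ map (false ∷_) (units n)

basis : (n : ℕ) → List (Point n)
basis n = 𝟎 ∷ units n

units-unique : (n : ℕ) → Unique (units n)
units-unique zero    = []
units-unique (suc n) = ¬Any⇒All¬ _ e₁∉ ∷ Unique.map⁺ ∷-injectiveʳ (units-unique n)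
  where
  e₁∉ : (true ∷ 𝟎) ∉ map (false ∷_) (units n)
  e₁∉ m with ∈-map⁻ (false ∷_) m
  ... | _ , _ , ()

𝟎∉units : (n : ℕ) → 𝟎 ∉ units n
𝟎∉units zero    ()
𝟎∉units (suc n) (there m) with ∈-map⁻ (false ∷_) m
... | u , u∈ , 𝟎≡u = 𝟎∉units n (subst (_∈ units n) (sym (∷-injectiveʳ 𝟎≡u)) u∈)

basis-unique : (n : ℕ) → Unique (basis n)
basis-unique n = ¬Any⇒All¬ _ (𝟎∉units n) ∷ units-unique n

-- Quads and caps

PairSum : List (Point n) → Point n → Set
PairSum S q = ∃ λ a → ∃ λ b → a ∈ S × b ∈ S × a ≢ b × q ≡ a ⊕ b

TripleSum : List (Point n) → Point n → Set
TripleSum S x = ∃ λ a → ∃ λ b → ∃ λ c →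
  a ∈ S × b ∈ S × c ∈ S × a ≢ b × a ≢ c × b ≢ c × x ≡ a ⊕ (b ⊕ c)

Blocked : List (Point n) → Point n → Set
Blocked S x = x ∈ S ⊎ TripleSum S x

Extendable : List (Point n) → Set
Extendable D = ∃ λ x → ¬ Blocked D x

PairSum-mono : {S S′ : List (Point n)} {q : Point n} → S ⊆ S′ → PairSum S q → PairSum S′ q
PairSum-mono S⊆S′ (a , b , a∈ , b∈ , rest) = a , b , S⊆S′ a∈ , S⊆S′ b∈ , rest

TripleSum-mono : {S S′ : List (Point n)} {x : Point n} → S ⊆ S′ → TripleSum S x → TripleSum S′ x
TripleSum-mono S⊆S′ (a , b , c , a∈ , b∈ , c∈ , rest) = a , b , c , S⊆S′ a∈ , S⊆S′ b∈ , S⊆S′ c∈ , rest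

Blocked-mono : {S S′ : List (Point n)} {x : Point n} → S ⊆ S′ → Blocked S x → Blocked S′ x
Blocked-mono S⊆S′ (inj₁ x∈) = inj₁ (S⊆S′ x∈)
Blocked-mono S⊆S′ (inj₂ t)  = inj₂ (TripleSum-mono S⊆S′ t)

isCap-[] : IsCap {n} []
isCap-[] = [] , λ { (_ , _ , _ , _ , () , _) }

∷-isCap : {D : List (Point n)} {x : Point n} → IsCap D → ¬ Blocked D x → IsCap (x ∷ D)
∷-isCap {D = D} {x} (unique , quadFree) unblocked = (¬Any⇒All¬ D (unblocked ∘ inj₁) ∷ unique) , quadFree′
  where
  quadFree′ : ¬ HasQuad (x ∷ D)
  quadFree′ (_ , _ , _ , _ , here refl , here refl , _ , _ , a≢b , _) = a≢b refl
  quadFree′ (_ , _ , _ , _ , here refl , _ , here refl , _ , _ , a≢c , _) = a≢c refl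
  quadFree′ (_ , _ , _ , _ , here refl , _ , _ , here refl , _ , _ , a≢d , _) = a≢d refl
  quadFree′ (_ , _ , _ , _ , _ , here refl , here refl , _ , _ , _ , _ , b≢c , _) = b≢c refl
  quadFree′ (_ , _ , _ , _ , _ , here refl , _ , here refl , _ , _ , _ , _ , b≢d , _) = b≢d refl
  quadFree′ (_ , _ , _ , _ , _ , _ , here refl , here refl , _ , _ , _ , _ , _ , c≢d , _) = c≢d refl
  quadFree′ (a , b , c , d , here refl , there b∈ , there c∈ , there d∈ , _ , _ , _ , b≢c , b≢d , c≢d , sum) =
    unblocked (inj₂ (b , c , d , b∈ , c∈ , d∈ , b≢c , b≢d , c≢d , quad-sum₁ sum))
  quadFree′ (a , b , c , d , there a∈ , here refl , there c∈ , there d∈ , _ , a≢c , a≢d , _ , _ , c≢d , sum) =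
    unblocked (inj₂ (a , c , d , a∈ , c∈ , d∈ , a≢c , a≢d , c≢d , quad-sum₂ sum))
  quadFree′ (a , b , c , d , there a∈ , there b∈ , here refl , there d∈ , a≢b , _ , a≢d , _ , b≢d , _ , sum) =
    unblocked (inj₂ (a , b , d , a∈ , b∈ , d∈ , a≢b , a≢d , b≢d , quad-sum₃ sum))
  quadFree′ (a , b , c , d , there a∈ , there b∈ , there c∈ , here refl , a≢b , a≢c , _ , b≢c , _ , _ , sum) =
    unblocked (inj₂ (a , b , c , a∈ , b∈ , c∈ , a≢b , a≢c , b≢c , quad-sum₄ sum))
  quadFree′ (a , b , c , d , there a∈ , there b∈ , there c∈ , there d∈ , rest) =
    quadFree (a , b , c , d , a∈ , b∈ , c∈ , d∈ , rest)

cap⇒¬Blocked : {D S : List (Point n)} {t : Point n} → IsCap D → S ⊆ D → t ∈ D → t ∉ S → ¬ Blocked S t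
cap⇒¬Blocked _ _ _ t∉S (inj₁ t∈S) = t∉S t∈S
cap⇒¬Blocked {S = S} {t} (_ , quadFree) S⊆D t∈D t∉S (inj₂ (a , b , c , a∈ , b∈ , c∈ , a≢b , a≢c , b≢c , t≡)) =
  quadFree (t , a , b , c , t∈D , S⊆D a∈ , S⊆D b∈ , S⊆D c∈ ,
            t≢ a∈ , t≢ b∈ , t≢ c∈ , a≢b , a≢c , b≢c , ≡⇒⊕≡𝟎 t≡)
  where
  t≢ : {y : Point _} → y ∈ S → t ≢ y
  t≢ y∈ refl = t∉S y∈

PreservesQuads ReflectsQuads : (Point k → Point n) → Set
PreservesQuads f = ∀ {a b c d} → sum₄ a b c d ≡ 𝟎 → sum₄ (f a) (f b) (f c) (f d) ≡ 𝟎
ReflectsQuads  f = ∀ {a b c d} → sum₄ (f a) (f b) (f c) (f d) ≡ 𝟎 → sum₄ a b c d ≡ 𝟎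

HasQuad-map⁺ : (f : Point k → Point n) → Injective _≡_ _≡_ f → PreservesQuads f →
               {A : List (Point k)} {E : List (Point n)} → (∀ {a} → a ∈ A → f a ∈ E) → HasQuad A → HasQuad E
HasQuad-map⁺ f f-injective f-quads A↦E
  (a , b , c , d , a∈ , b∈ , c∈ , d∈ , a≢b , a≢c , a≢d , b≢c , b≢d , c≢d , sum) =
  f a , f b , f c , f d , A↦E a∈ , A↦E b∈ , A↦E c∈ , A↦E d∈ ,
  a≢b ∘ f-injective , a≢c ∘ f-injective , a≢d ∘ f-injective ,
  b≢c ∘ f-injective , b≢d ∘ f-injective , c≢d ∘ f-injective , f-quads sum

HasQuad-map⁻ : (f : Point k → Point n) → ReflectsQuads f →
               {A : List (Point k)} {E : List (Point n)} → (∀ {e} → e ∈ E → ∃ λ a → a ∈ A × e ≡ f a) →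
               HasQuad E → HasQuad A
HasQuad-map⁻ f f-quads E↤A (_ , _ , _ , _ , a∈ , b∈ , c∈ , d∈ , a≢b , a≢c , a≢d , b≢c , b≢d , c≢d , sum)
  with E↤A a∈ | E↤A b∈ | E↤A c∈ | E↤A d∈
... | a , a∈′ , refl | b , b∈′ , refl | c , c∈′ , refl | d , d∈′ , refl =
  a , b , c , d , a∈′ , b∈′ , c∈′ , d∈′ ,
  a≢b ∘ cong f , a≢c ∘ cong f , a≢d ∘ cong f , b≢c ∘ cong f , b≢d ∘ cong f , c≢d ∘ cong f , f-quads sum

HasQuad-mono : {A E : List (Point n)} → A ⊆ E → HasQuad A → HasQuad E
HasQuad-mono = HasQuad-map⁺ id id id

-- Sets of points as bit tries

data PointSet : ℕ → Set where
  leaf   : Bool → PointSet zero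
  branch : PointSet n → PointSet n → PointSet (suc n)

∅ : (n : ℕ) → PointSet n
∅ zero    = leaf false
∅ (suc n) = branch (∅ n) (∅ n)

member : PointSet n → Point n → Bool
member (leaf b)     []          = b
member (branch l r) (false ∷ x) = member l x
member (branch l r) (true ∷ x)  = member r x

insert : Point n → PointSet n → PointSet n
insert []          (leaf _)     = leaf true
insert (false ∷ x) (branch l r) = branch (insert x l) r
insert (true ∷ x)  (branch l r) = branch l (insert x r)

insertAll : List (Point n) → PointSet n → PointSet n
insertAll xs B = foldr insert B xs

notFull : PointSet n → Bool
notFull (leaf b)     = not b
notFull (branch l r) = notFull l ∨ notFull r

member-∅ : (x : Point n) → member (∅ n) x ≡ false
member-∅ []          = refl
member-∅ (false ∷ x) = member-∅ x
member-∅ (true ∷ x)  = member-∅ x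

member-insert-self : (x : Point n) (B : PointSet n) → member (insert x B) x ≡ true
member-insert-self []          (leaf _)     = refl
member-insert-self (false ∷ x) (branch l r) = member-insert-self x l
member-insert-self (true ∷ x)  (branch l r) = member-insert-self x r

member-insert-mono : (y x : Point n) (B : PointSet n) → member B x ≡ true → member (insert y B) x ≡ true
member-insert-mono []          []          (leaf _)     _ = refl
member-insert-mono (false ∷ y) (false ∷ x) (branch l r) h = member-insert-mono y x l h
member-insert-mono (false ∷ y) (true ∷ x)  (branch l r) h = h
member-insert-mono (true ∷ y)  (false ∷ x) (branch l r) h = h
member-insert-mono (true ∷ y)  (true ∷ x)  (branch l r) h = member-insert-mono y x r h

member-insert⁻ : (y x : Point n) (B : PointSet n) → member (insert y B) x ≡ true → x ≡ y ⊎ member B x ≡ true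
member-insert⁻ []          []          (leaf _)     _ = inj₁ refl
member-insert⁻ (false ∷ y) (false ∷ x) (branch l r) h with member-insert⁻ y x l h
... | inj₁ refl = inj₁ refl
... | inj₂ h′   = inj₂ h′
member-insert⁻ (false ∷ y) (true ∷ x)  (branch l r) h = inj₂ h
member-insert⁻ (true ∷ y)  (false ∷ x) (branch l r) h = inj₂ h
member-insert⁻ (true ∷ y)  (true ∷ x)  (branch l r) h with member-insert⁻ y x r h
... | inj₁ refl = inj₁ refl
... | inj₂ h′   = inj₂ h′

member-insertAll-mono : (ys : List (Point n)) (x : Point n) (B : PointSet n) →
                        member B x ≡ true → member (insertAll ys B) x ≡ true
member-insertAll-mono []       x B h = h
member-insertAll-mono (y ∷ ys) x B h = member-insert-mono y x _ (member-insertAll-mono ys x B h)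

member-insertAll-∈ : (ys : List (Point n)) (x : Point n) (B : PointSet n) → x ∈ ys → member (insertAll ys B) x ≡ true
member-insertAll-∈ (y ∷ ys) x B (here refl) = member-insert-self x _
member-insertAll-∈ (y ∷ ys) x B (there x∈) = member-insert-mono y x _ (member-insertAll-∈ ys x B x∈)

member-insertAll⁻ : (ys : List (Point n)) (x : Point n) (B : PointSet n) →
                    member (insertAll ys B) x ≡ true → x ∈ ys ⊎ member B x ≡ true
member-insertAll⁻ []       x B h = inj₂ h
member-insertAll⁻ (y ∷ ys) x B h with member-insert⁻ y x _ h
... | inj₁ x≡y = inj₁ (here x≡y)
... | inj₂ h′ with member-insertAll⁻ ys x B h′
...   | inj₁ x∈ = inj₁ (there x∈)
...   | inj₂ h″ = inj₂ h″

notFull⇒nonMember : (B : PointSet n) → notFull B ≡ true → ∃ λ x → member B x ≡ false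
notFull⇒nonMember (leaf false)  _ = [] , refl
notFull⇒nonMember (branch l r) h with notFull l in eq
... | true  = let (x , x∉l) = notFull⇒nonMember l eq in (false ∷ x) , x∉l
... | false = let (x , x∉r) = notFull⇒nonMember r h  in (true ∷ x) , x∉r

-- Caps under construction

record State (n : ℕ) : Set where
  constructor state
  field
    chosen   : List (Point n)
    pairSums : List (Point n)
    blocked  : PointSet n
open State

emptyState : (n : ℕ) → State n
emptyState n = state [] [] (∅ n)

addPoint : Point n → State n → State n
addPoint c (state S P B) = state (c ∷ S) (map (c ⊕_) S ++ P) (insert c (insertAll (map (c ⊕_) P) B))

addPoints : List (Point n) → State n → State n
addPoints []       s = s
addPoints (c ∷ cs) s = addPoints cs (addPoint c s)

record Valid (s : State n) : Set where
  field
    chosen-unique     : Unique (chosen s)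
    pairSums-sound    : ∀ {q} → q ∈ pairSums s → PairSum (chosen s) q
    pairSums-complete : ∀ {q} → PairSum (chosen s) q → q ∈ pairSums s
    blocked-sound     : ∀ {x} → member (blocked s) x ≡ true → Blocked (chosen s) x
    blocked-complete  : ∀ {x} → Blocked (chosen s) x → member (blocked s) x ≡ true
open Valid

valid-empty : Valid (emptyState n)
valid-empty = record
  { chosen-unique     = []
  ; pairSums-sound    = λ ()
  ; pairSums-complete = λ { (_ , _ , () , _) }
  ; blocked-sound     = λ {x} h → contradiction (trans (sym (member-∅ x)) h) λ ()
  ; blocked-complete  = λ { (inj₁ ()) ; (inj₂ (_ , _ , _ , () , _)) }
  }

valid⇒¬Blocked : {s : State n} {x : Point n} → Valid s → member (blocked s) x ≡ false → ¬ Blocked (chosen s) x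
valid⇒¬Blocked v x∉B b = contradiction (trans (sym x∉B) (blocked-complete v b)) λ ()

valid⇒member≡false : {s : State n} {x : Point n} → Valid s → ¬ Blocked (chosen s) x → member (blocked s) x ≡ false
valid⇒member≡false {s = s} {x} v ¬b with member (blocked s) x in eq
... | false = refl
... | true  = contradiction (blocked-sound v eq) ¬b

pairSum-∷⁻ : {S : List (Point n)} {c q : Point n} → PairSum (c ∷ S) q → q ∈ map (c ⊕_) S ⊎ PairSum S q
pairSum-∷⁻ (_ , _ , here refl , here refl , a≢b , _)    = contradiction refl a≢b
pairSum-∷⁻ (a , _ , here refl , there b∈ , _ , refl)     = inj₁ (∈-map⁺ (a ⊕_) b∈)
pairSum-∷⁻ (a , b , there a∈ , here refl , _ , refl)     = inj₁ (subst (_∈ _) (⊕-comm b a) (∈-map⁺ (b ⊕_) a∈))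
pairSum-∷⁻ (a , b , there a∈ , there b∈ , a≢b , q≡)     = inj₂ (a , b , a∈ , b∈ , a≢b , q≡)

pairSum-∷-new : {S : List (Point n)} {c a : Point n} → c ∉ S → a ∈ S → PairSum (c ∷ S) (c ⊕ a)
pairSum-∷-new {c = c} {a} c∉S a∈ = c , a , here refl , there a∈ , (λ { refl → c∉S a∈ }) , refl

tripleSum-∷⁻ : {S : List (Point n)} {c x : Point n} → TripleSum (c ∷ S) x →
               (∃ λ q → PairSum S q × x ≡ c ⊕ q) ⊎ TripleSum S x
tripleSum-∷⁻ (_ , _ , _ , here refl , here refl , _ , a≢b , _) = contradiction refl a≢b
tripleSum-∷⁻ (_ , _ , _ , here refl , _ , here refl , _ , a≢d , _) = contradiction refl a≢d
tripleSum-∷⁻ (_ , _ , _ , _ , here refl , here refl , _ , _ , b≢d , _) = contradiction refl b≢d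
tripleSum-∷⁻ (a , b , d , here refl , there b∈ , there d∈ , _ , _ , b≢d , x≡) =
  inj₁ (b ⊕ d , (b , d , b∈ , d∈ , b≢d , refl) , x≡)
tripleSum-∷⁻ (a , b , d , there a∈ , here refl , there d∈ , _ , a≢d , _ , x≡) =
  inj₁ (a ⊕ d , (a , d , a∈ , d∈ , a≢d , refl) , trans x≡ (x∙yz≈y∙xz a b d))
tripleSum-∷⁻ (a , b , d , there a∈ , there b∈ , here refl , a≢b , _ , _ , x≡) =
  inj₁ (a ⊕ b , (a , b , a∈ , b∈ , a≢b , refl) , trans x≡ (x∙yz≈z∙xy a b d))
tripleSum-∷⁻ (a , b , d , there a∈ , there b∈ , there d∈ , rest) = inj₂ (a , b , d , a∈ , b∈ , d∈ , rest)

tripleSum-∷-new : {S : List (Point n)} {c q : Point n} → c ∉ S → PairSum S q → TripleSum (c ∷ S) (c ⊕ q)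
tripleSum-∷-new {c = c} c∉S (a , b , a∈ , b∈ , a≢b , refl) =
  c , a , b , here refl , there a∈ , there b∈ , (λ { refl → c∉S a∈ }) , (λ { refl → c∉S b∈ }) , a≢b , refl

valid-addPoint : {s : State n} {c : Point n} → Valid s → c ∉ chosen s → Valid (addPoint c s)
valid-addPoint {s = s} {c} v c∉ = record
  { chosen-unique     = ¬Any⇒All¬ (chosen s) c∉ ∷ chosen-unique v
  ; pairSums-sound    = sound
  ; pairSums-complete = complete
  ; blocked-sound     = blockedSound
  ; blocked-complete  = blockedComplete
  }
  where
  sound : ∀ {q} → q ∈ map (c ⊕_) (chosen s) ++ pairSums s → PairSum (c ∷ chosen s) q
  sound q∈ with ∈-++⁻ (map (c ⊕_) (chosen s)) q∈
  ... | inj₂ q∈old = PairSum-mono there (pairSums-sound v q∈old)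
  ... | inj₁ q∈new with ∈-map⁻ (c ⊕_) q∈new
  ...   | a , a∈ , refl = pairSum-∷-new c∉ a∈

  complete : ∀ {q} → PairSum (c ∷ chosen s) q → q ∈ map (c ⊕_) (chosen s) ++ pairSums s
  complete p with pairSum-∷⁻ p
  ... | inj₁ q∈new = ∈-++⁺ˡ q∈new
  ... | inj₂ p′    = ∈-++⁺ʳ (map (c ⊕_) (chosen s)) (pairSums-complete v p′)

  B′ : PointSet _
  B′ = insertAll (map (c ⊕_) (pairSums s)) (blocked s)

  blockedSound : ∀ {x} → member (insert c B′) x ≡ true → Blocked (c ∷ chosen s) x
  blockedSound {x} h with member-insert⁻ c x B′ h
  ... | inj₁ refl = inj₁ (here refl)
  ... | inj₂ h′ with member-insertAll⁻ (map (c ⊕_) (pairSums s)) x (blocked s) h′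
  ...   | inj₂ h″ = Blocked-mono there (blocked-sound v h″)
  ...   | inj₁ x∈ with ∈-map⁻ (c ⊕_) x∈
  ...     | q , q∈ , refl = inj₂ (tripleSum-∷-new c∉ (pairSums-sound v q∈))

  blockedComplete : ∀ {x} → Blocked (c ∷ chosen s) x → member (insert c B′) x ≡ true
  blockedComplete {x} b with b
  ... | inj₁ (here refl) = member-insert-self c B′
  ... | inj₁ (there x∈)  = wasBlocked (blocked-complete v (inj₁ x∈))
    where wasBlocked = member-insert-mono c x B′ ∘ member-insertAll-mono (map (c ⊕_) (pairSums s)) x (blocked s)
  ... | inj₂ t with tripleSum-∷⁻ t
  ...   | inj₁ (q , p , refl) =
          member-insert-mono c x B′ (member-insertAll-∈ _ x (blocked s) (∈-map⁺ (c ⊕_) (pairSums-complete v p)))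
  ...   | inj₂ t′ =
          member-insert-mono c x B′ (member-insertAll-mono (map (c ⊕_) (pairSums s)) x (blocked s) (blocked-complete v (inj₂ t′)))

∈-chosen-addPoints⁺ : (T : List (Point n)) {s : State n} {x : Point n} → x ∈ T ⊎ x ∈ chosen s → x ∈ chosen (addPoints T s)
∈-chosen-addPoints⁺ []      (inj₂ x∈)        = x∈
∈-chosen-addPoints⁺ (c ∷ T) (inj₁ (here refl)) = ∈-chosen-addPoints⁺ T (inj₂ (here refl))
∈-chosen-addPoints⁺ (c ∷ T) (inj₁ (there x∈))  = ∈-chosen-addPoints⁺ T (inj₁ x∈)
∈-chosen-addPoints⁺ (c ∷ T) (inj₂ x∈)          = ∈-chosen-addPoints⁺ T (inj₂ (there x∈))

∈-chosen-addPoints⁻ : (T : List (Point n)) {s : State n} {x : Point n} → x ∈ chosen (addPoints T s) → x ∈ T ⊎ x ∈ chosen s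
∈-chosen-addPoints⁻ []      x∈ = inj₂ x∈
∈-chosen-addPoints⁻ (c ∷ T) x∈ with ∈-chosen-addPoints⁻ T x∈
... | inj₁ x∈T         = inj₁ (there x∈T)
... | inj₂ (here refl) = inj₁ (here refl)
... | inj₂ (there x∈s) = inj₂ x∈s

valid-addPoints : (T : List (Point n)) {s : State n} → Valid s → Unique T → Disjoint T (chosen s) → Valid (addPoints T s)
valid-addPoints []      v _              _        = v
valid-addPoints (c ∷ T) v (c∉T ∷ unique) disjoint =
  valid-addPoints T (valid-addPoint v (λ c∈ → disjoint (here refl , c∈))) unique disjoint′
  where
  disjoint′ : Disjoint T (c ∷ _)
  disjoint′ (c∈T , here refl) = All¬⇒¬Any c∉T c∈T
  disjoint′ (y∈T , there y∈)  = disjoint (there y∈T , y∈)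

-- Depth-first search

admissible : State n → List (Point n) → Bool
admissible s []       = true
admissible s (c ∷ cs) = if member (blocked s) c then false else admissible (addPoint c s) cs

cap⇒admissible : (T : List (Point n)) {s : State n} {D : List (Point n)} → Valid s → IsCap D →
                 chosen s ⊆ D → T ⊆ D → Unique T → Disjoint T (chosen s) → admissible s T ≡ true
cap⇒admissible []      _ _   _     _   _              _        = refl
cap⇒admissible (c ∷ T) {s} v cap s⊆D T⊆D (c∉T ∷ unique) disjoint
  rewrite valid⇒member≡false {s = s} {c} v (cap⇒¬Blocked cap s⊆D (T⊆D (here refl)) (λ c∈ → disjoint (here refl , c∈))) =
  cap⇒admissible T (valid-addPoint v (λ c∈ → disjoint (here refl , c∈))) cap s⊆D′ (T⊆D ∘ there) unique disjoint′
  where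
  s⊆D′ : c ∷ chosen s ⊆ _
  s⊆D′ (here refl) = T⊆D (here refl)
  s⊆D′ (there y∈)  = s⊆D y∈
  disjoint′ : Disjoint T (c ∷ chosen s)
  disjoint′ (c∈T , here refl) = All¬⇒¬Any c∉T c∈T
  disjoint′ (y∈T , there y∈)  = disjoint (there y∈T , y∈)

admissible⇒isCap : (T : List (Point n)) {s : State n} → Valid s → IsCap (chosen s) →
                   admissible s T ≡ true → IsCap (chosen (addPoints T s))
admissible⇒isCap []      _ cap _ = cap
admissible⇒isCap (c ∷ T) {s} v cap h with member (blocked s) c in eq
... | false = admissible⇒isCap T (valid-addPoint v (unblocked ∘ inj₁)) (∷-isCap cap unblocked) h
  where unblocked = valid⇒¬Blocked v eq
admissible⇒isCap (c ∷ T) v cap () | true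

∧≡true : (a : Bool) {b : Bool} → a ∧ b ≡ true → a ≡ true × b ≡ true
∧≡true true h = refl , h

∧-intro : {a b : Bool} → a ≡ true → b ≡ true → a ∧ b ≡ true
∧-intro refl refl = refl

module DepthFirst (ok : State n → Bool) where

  mutual
    allExtensionsOk : State n → List (Point n) → Bool
    allExtensionsOk s cs = ok s ∧ allChildrenOk s cs

    allChildrenOk : State n → List (Point n) → Bool
    allChildrenOk s []       = true
    allChildrenOk s (c ∷ cs) =
      (if member (blocked s) c then true else allExtensionsOk (addPoint c s) cs) ∧ allChildrenOk s cs

  allExtensionsOk⇒ok : (s : State n) {cs T : List (Point n)} → allExtensionsOk s cs ≡ true → T ⊑ cs →
                       admissible s T ≡ true → ok (addPoints T s) ≡ true
  allExtensionsOk⇒ok s h [] _ = proj₁ (∧≡true (ok s) h)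
  allExtensionsOk⇒ok s h (_ ∷ʳ T⊑cs) admissibleT = allExtensionsOk⇒ok s h′ T⊑cs admissibleT
    where
    okHere = ∧≡true (ok s) h
    h′ = ∧-intro (proj₁ okHere) (proj₂ (∧≡true _ (proj₂ okHere)))
  allExtensionsOk⇒ok s {c ∷ cs} h (refl ∷ T⊑cs) admissibleT with member (blocked s) c
  ... | false = allExtensionsOk⇒ok (addPoint c s) (proj₁ (∧≡true _ (proj₂ (∧≡true (ok s) h)))) T⊑cs admissibleT
  allExtensionsOk⇒ok s h (refl ∷ T⊑cs) () | true

root : (n : ℕ) → State n
root n = addPoints (basis n) (emptyState n)

valid-root : Valid (root n)
valid-root {n} = valid-addPoints (basis n) valid-empty (basis-unique n) λ ()

chosen-root⊆basis : chosen (root n) ⊆ basis n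
chosen-root⊆basis {n} x∈ with ∈-chosen-addPoints⁻ (basis n) x∈
... | inj₁ x∈basis = x∈basis

search-complete : (ok : State n → Bool) → DepthFirst.allExtensionsOk ok (root n) (allPoints n) ≡ true →
                  {D : List (Point n)} → IsCap D → basis n ⊆ D →
                  ∃ λ s → ok s ≡ true × Valid s × chosen s ⊆ D × D ⊆ chosen s
-- The search reaches D by adding the points of D outside the basis in the order of allPoints.
search-complete {n} ok h {D} cap basis⊆D =
  addPoints T (root n) ,
  DepthFirst.allExtensionsOk⇒ok ok (root n) h (filter-⊆ new? (allPoints n))
    (cap⇒admissible T valid-root cap root⊆D T⊆D uniqueT disjointT) ,
  valid-addPoints T valid-root uniqueT disjointT ,
  chosen⊆D ,
  D⊆chosen
  where
  new? : (y : Point n) → Dec (y ∈ D × y ∉ basis n)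
  new? y = (y ∈? D) ×-dec ¬? (y ∈? basis n)
  T = filter new? (allPoints n)
  T⊆D : T ⊆ D
  T⊆D y∈ = proj₁ (proj₂ (∈-filter⁻ new? {xs = allPoints n} y∈))
  uniqueT : Unique T
  uniqueT = Unique.filter⁺ new? (allPoints-unique n)
  disjointT : Disjoint T (chosen (root n))
  disjointT (y∈T , y∈root) = proj₂ (proj₂ (∈-filter⁻ new? {xs = allPoints n} y∈T)) (chosen-root⊆basis y∈root)
  root⊆D : chosen (root n) ⊆ D
  root⊆D = basis⊆D ∘ chosen-root⊆basis
  chosen⊆D : chosen (addPoints T (root n)) ⊆ D
  chosen⊆D y∈ with ∈-chosen-addPoints⁻ T y∈
  ... | inj₁ y∈T    = T⊆D y∈T
  ... | inj₂ y∈root = root⊆D y∈root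
  D⊆chosen : D ⊆ chosen (addPoints T (root n))
  D⊆chosen {y} y∈D with y ∈? basis n
  ... | yes y∈basis = ∈-chosen-addPoints⁺ T (inj₂ (∈-chosen-addPoints⁺ (basis n) (inj₁ y∈basis)))
  ... | no  y∉basis = ∈-chosen-addPoints⁺ T (inj₁ (∈-filter⁺ new? (∈-allPoints y) (y∈D , y∉basis)))

-- Caps containing the standard frame

FramedCap : List (Point n) → Set
FramedCap {n} D = IsCap D × basis n ⊆ D

CapBound : ℕ → ℕ → Set
CapBound k m = {D : List (Point k)} → FramedCap D → length D ≤ m

ExtendableBelow : ℕ → ℕ → Set
ExtendableBelow k m = {D : List (Point k)} → FramedCap D → length D < m → Extendable D

lift : List (Point k) → List (Point (suc k))
lift D = (true ∷ 𝟎) ∷ map (false ∷_) D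

framedCap-lift : {D : List (Point k)} → FramedCap D → FramedCap (lift D)
framedCap-lift {k} {D} ((unique , quadFree) , basis⊆D) = ∷-isCap cap₀ e₁-unblocked , basis⊆lift
  where
  cap₀ : IsCap (map (false ∷_) D)
  cap₀ = Unique.map⁺ ∷-injectiveʳ unique , quadFree ∘ HasQuad-map⁻ (false ∷_) ∷-injectiveʳ (∈-map⁻ (false ∷_))
  e₁-unblocked : ¬ Blocked (map (false ∷_) D) (true ∷ 𝟎)
  e₁-unblocked (inj₁ e₁∈) with ∈-map⁻ (false ∷_) e₁∈
  ... | _ , _ , ()
  e₁-unblocked (inj₂ (_ , _ , _ , a∈ , b∈ , c∈ , _ , _ , _ , e₁≡))
    with ∈-map⁻ (false ∷_) a∈ | ∈-map⁻ (false ∷_) b∈ | ∈-map⁻ (false ∷_) c∈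
  ... | _ , _ , refl | _ , _ , refl | _ , _ , refl = contradiction e₁≡ λ ()
  basis⊆lift : basis (suc k) ⊆ lift D
  basis⊆lift (here refl)         = there (∈-map⁺ (false ∷_) (basis⊆D (here refl)))
  basis⊆lift (there (here refl)) = here refl
  basis⊆lift (there (there x∈)) with ∈-map⁻ (false ∷_) x∈
  ... | _ , u∈ , refl = there (∈-map⁺ (false ∷_) (basis⊆D (there u∈)))

capBound-pred : {m : ℕ} → CapBound (suc k) m → CapBound k m
capBound-pred {m = m} bound {D} framed =
  ≤-trans (n≤1+n (length D)) (subst (λ l → suc l ≤ m) (length-map (false ∷_) D) (bound (framedCap-lift framed)))

capBound-≤′ : {j m : ℕ} → k ≤′ j → CapBound j m → CapBound k m
capBound-≤′ ≤′-refl         bound = bound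
capBound-≤′ (≤′-step k≤′j) bound = capBound-≤′ k≤′j (capBound-pred bound)

-- Affine maps and the affine span

combination : Vec (Point n) k → Point k → Point n
combination []       []          = 𝟎
combination (v ∷ vs) (false ∷ x) = combination vs x
combination (v ∷ vs) (true ∷ x)  = v ⊕ combination vs x

combination-𝟎 : (vs : Vec (Point n) k) → combination vs 𝟎 ≡ 𝟎
combination-𝟎 []       = refl
combination-𝟎 (v ∷ vs) = combination-𝟎 vs

combination-⊕ : (vs : Vec (Point n) k) (x y : Point k) →
                combination vs (x ⊕ y) ≡ combination vs x ⊕ combination vs y
combination-⊕ []       []          []          = sym (⊕-identityˡ 𝟎)
combination-⊕ (v ∷ vs) (false ∷ x) (false ∷ y) = combination-⊕ vs x y
combination-⊕ (v ∷ vs) (false ∷ x) (true ∷ y)  =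
  trans (cong (v ⊕_) (combination-⊕ vs x y)) (x∙yz≈y∙xz v (combination vs x) (combination vs y))
combination-⊕ (v ∷ vs) (true ∷ x)  (false ∷ y) =
  trans (cong (v ⊕_) (combination-⊕ vs x y)) (sym (⊕-assoc v (combination vs x) (combination vs y)))
combination-⊕ (v ∷ vs) (true ∷ x)  (true ∷ y)  =
  trans (combination-⊕ vs x y) (sym (⊕-cancel-common v (combination vs x) (combination vs y)))

Independent : Vec (Point n) k → Set
Independent {k = k} vs = (x : Point k) → combination vs x ≡ 𝟎 → x ≡ 𝟎

affineMap : Point n → Vec (Point n) k → Point k → Point n
affineMap o vs x = o ⊕ combination vs x

module _ (o : Point n) (vs : Vec (Point n) k) where

  private
    ψ = affineMap o vs

  affineMap-injective : Independent vs → Injective _≡_ _≡_ ψ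
  affineMap-injective independent {x} {y} ψx≡ψy = ⊕≡𝟎⇒≡ (independent (x ⊕ y) (begin
    combination vs (x ⊕ y)               ≡⟨ combination-⊕ vs x y ⟩
    combination vs x ⊕ combination vs y  ≡⟨ ⊕-cancel-common o _ _ ⟨
    ψ x ⊕ ψ y                            ≡⟨ ≡⇒⊕≡𝟎 ψx≡ψy ⟩
    𝟎                                    ∎))
    where open ≡-Reasoning

  affineMap-sum₄ : (a b c d : Point k) → sum₄ (ψ a) (ψ b) (ψ c) (ψ d) ≡ combination vs (sum₄ a b c d)
  affineMap-sum₄ a b c d = begin
    (o ⊕ ca) ⊕ ((o ⊕ cb) ⊕ ((o ⊕ cc) ⊕ (o ⊕ cd)))
      ≡⟨ cong (λ z → (o ⊕ ca) ⊕ ((o ⊕ cb) ⊕ z)) (⊕-cancel-common o cc cd) ⟩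
    (o ⊕ ca) ⊕ ((o ⊕ cb) ⊕ (cc ⊕ cd))
      ≡⟨ cong ((o ⊕ ca) ⊕_) (⊕-assoc o cb (cc ⊕ cd)) ⟩
    (o ⊕ ca) ⊕ (o ⊕ (cb ⊕ (cc ⊕ cd)))
      ≡⟨ ⊕-cancel-common o ca _ ⟩
    ca ⊕ (cb ⊕ (cc ⊕ cd))
      ≡⟨ cong (λ z → ca ⊕ (cb ⊕ z)) (combination-⊕ vs c d) ⟨
    ca ⊕ (cb ⊕ combination vs (c ⊕ d))
      ≡⟨ cong (ca ⊕_) (combination-⊕ vs b (c ⊕ d)) ⟨
    ca ⊕ combination vs (b ⊕ (c ⊕ d))
      ≡⟨ combination-⊕ vs a _ ⟨
    combination vs (sum₄ a b c d)
      ∎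
    where
    open ≡-Reasoning
    ca = combination vs a
    cb = combination vs b
    cc = combination vs c
    cd = combination vs d

  affineMap-preservesQuads : PreservesQuads ψ
  affineMap-preservesQuads {a} {b} {c} {d} sum =
    trans (affineMap-sum₄ a b c d) (trans (cong (combination vs) sum) (combination-𝟎 vs))

  affineMap-reflectsQuads : Independent vs → ReflectsQuads ψ
  affineMap-reflectsQuads independent {a} {b} {c} {d} sum =
    independent (sum₄ a b c d) (trans (sym (affineMap-sum₄ a b c d)) sum)

parity : Vec Bool k → Bool
parity []      = false
parity (b ∷ m) = b xor parity m

parity-𝟎 : (k : ℕ) → parity (𝟎 {k}) ≡ false
parity-𝟎 zero    = refl
parity-𝟎 (suc k) = parity-𝟎 k

parity-⊕ : (m₁ m₂ : Vec Bool k) → parity (m₁ ⊕ m₂) ≡ parity m₁ xor parity m₂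
parity-⊕ []       []       = refl
parity-⊕ (a ∷ m₁) (b ∷ m₂) =
  trans (cong ((a xor b) xor_) (parity-⊕ m₁ m₂)) (xor-interchange a b (parity m₁) (parity m₂))

-- y ∈ aff C, with the odd-size subset of C encoded as a mask so that linear algebra applies.
record InAffineSpan (C : List (Point n)) (y : Point n) : Set where
  constructor oddCombination
  field
    mask : Vec Bool (length C)
    odd  : parity mask ≡ true
    sum  : combination (fromList C) mask ≡ y

inAffineSpan-∈ : {C : List (Point n)} {c : Point n} → c ∈ C → InAffineSpan C c
inAffineSpan-∈ {C = x ∷ C} (here refl) =
  oddCombination (true ∷ 𝟎) (cong not (parity-𝟎 (length C)))
    (trans (cong (x ⊕_) (combination-𝟎 (fromList C))) (⊕-identityʳ x))
inAffineSpan-∈ {C = x ∷ C} (there c∈) with inAffineSpan-∈ c∈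
... | oddCombination m odd sum = oddCombination (false ∷ m) odd sum

inAffineSpan-sum₃ : {C : List (Point n)} {x y z : Point n} →
                    InAffineSpan C x → InAffineSpan C y → InAffineSpan C z → InAffineSpan C (x ⊕ (y ⊕ z))
inAffineSpan-sum₃ {C = C} (oddCombination m₁ odd₁ refl) (oddCombination m₂ odd₂ refl) (oddCombination m₃ odd₃ refl) =
  oddCombination (m₁ ⊕ (m₂ ⊕ m₃))
    (trans (parity-⊕ m₁ (m₂ ⊕ m₃)) (cong₂ _xor_ odd₁ (trans (parity-⊕ m₂ m₃) (cong₂ _xor_ odd₂ odd₃))))
    (trans (combination-⊕ (fromList C) m₁ _) (cong (_ ⊕_) (combination-⊕ (fromList C) m₂ m₃)))

select : (C : List (Point n)) → Vec Bool (length C) → List (Point n)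
select []      []          = []
select (c ∷ C) (true ∷ m)  = c ∷ select C m
select (c ∷ C) (false ∷ m) = select C m

isOdd-suc : (k : ℕ) → isOdd (suc k) ≡ not (isOdd k)
isOdd-suc k with isOdd k
... | true  = refl
... | false = refl

isOdd-select : (C : List (Point n)) (m : Vec Bool (length C)) → isOdd (length (select C m)) ≡ parity m
isOdd-select []      []          = refl
isOdd-select (c ∷ C) (false ∷ m) = isOdd-select C m
isOdd-select (c ∷ C) (true ∷ m)  = trans (isOdd-suc (length (select C m))) (cong not (isOdd-select C m))

sumP-select : (C : List (Point n)) (m : Vec Bool (length C)) → sumP (select C m) ≡ combination (fromList C) m
sumP-select []      []          = refl
sumP-select (c ∷ C) (false ∷ m) = sumP-select C m
sumP-select (c ∷ C) (true ∷ m)  = cong (c ⊕_) (sumP-select C m)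

select-∈-sublists : (C : List (Point n)) (m : Vec Bool (length C)) → select C m ∈ sublists C
select-∈-sublists []      []          = here refl
select-∈-sublists (c ∷ C) (false ∷ m) = ∈-++⁺ˡ (select-∈-sublists C m)
select-∈-sublists (c ∷ C) (true ∷ m)  = ∈-++⁺ʳ (sublists C) (∈-map⁺ (c ∷_) (select-∈-sublists C m))

sublists-⊆ : (C : List (Point n)) {T : List (Point n)} → T ∈ sublists C → T ⊆ C
sublists-⊆ []      (here refl) ()
sublists-⊆ (c ∷ C) T∈ t∈ with ∈-++⁻ (sublists C) T∈
... | inj₁ T∈′ = there (sublists-⊆ C T∈′ t∈)
... | inj₂ T∈′ with ∈-map⁻ (c ∷_) T∈′
...   | T′ , T′∈ , refl with t∈
...     | here refl = here refl
...     | there t∈′ = there (sublists-⊆ C T′∈ t∈′)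

odd? : (T : List (Point n)) → Dec (isOdd (length T) ≡ true)
odd? T = isOdd (length T) ≟B true

inAffineSpan⇒∈aff : {C : List (Point n)} {y : Point n} → InAffineSpan C y → y ∈ aff C
inAffineSpan⇒∈aff {C = C} (oddCombination m odd refl) = subst (_∈ aff C) (sumP-select C m)
  (∈-map⁺ sumP (∈-filter⁺ odd? (select-∈-sublists C m) (trans (isOdd-select C m) odd)))

sumP-images : (o : Point n) (vs : Vec (Point n) k) (T : List (Point n)) →
              (∀ {t} → t ∈ T → ∃ λ x → affineMap o vs x ≡ t) →
              ∃ λ x → sumP T ≡ (if isOdd (length T) then affineMap o vs x else combination vs x)
sumP-images o vs []      _      = 𝟎 , sym (combination-𝟎 vs)
sumP-images o vs (t ∷ T) images with images (here refl) | sumP-images o vs T (images ∘ there)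
... | x , refl | y , sumT≡ with isOdd (length T)
...   | true  = x ⊕ y , (begin
  affineMap o vs x ⊕ sumP T                      ≡⟨ cong (affineMap o vs x ⊕_) sumT≡ ⟩
  (o ⊕ combination vs x) ⊕ (o ⊕ combination vs y) ≡⟨ ⊕-cancel-common o _ _ ⟩
  combination vs x ⊕ combination vs y            ≡⟨ combination-⊕ vs x y ⟨
  combination vs (x ⊕ y)                         ∎)
  where open ≡-Reasoning
...   | false = x ⊕ y , (begin
  affineMap o vs x ⊕ sumP T                      ≡⟨ cong (affineMap o vs x ⊕_) sumT≡ ⟩
  (o ⊕ combination vs x) ⊕ combination vs y      ≡⟨ ⊕-assoc o _ _ ⟩
  o ⊕ (combination vs x ⊕ combination vs y)      ≡⟨ cong (o ⊕_) (combination-⊕ vs x y) ⟨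
  affineMap o vs (x ⊕ y)                         ∎)
  where open ≡-Reasoning

-- Affine coordinates ψ : Z_2^dim → aff C, built greedily from points of C; L is the part
-- of C covered so far.
record Frame (C L : List (Point n)) : Set where
  field
    dim         : ℕ
    origin      : Point n
    directions  : Vec (Point n) dim
    independent : Independent directions
    basis↦C     : ∀ {x} → x ∈ basis dim → affineMap origin directions x ∈ C
    image⊆span  : ∀ x → InAffineSpan C (affineMap origin directions x)
    covers      : ∀ {c} → c ∈ L → ∃ λ x → affineMap origin directions x ≡ c

  ψ : Point dim → Point n
  ψ = affineMap origin directions

  origin∈C : origin ∈ C
  origin∈C = subst (_∈ C) (trans (cong (origin ⊕_) (combination-𝟎 directions)) (⊕-identityʳ origin)) (basis↦C (here refl))

initialFrame : {c₀ : Point n} {C : List (Point n)} → Frame (c₀ ∷ C) []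
initialFrame {c₀ = c₀} = record
  { dim         = 0
  ; origin      = c₀
  ; directions  = []
  ; independent = λ { [] _ → refl }
  ; basis↦C     = λ { (here refl) → here (⊕-identityʳ c₀) ; (there ()) }
  ; image⊆span  = λ { [] → subst (InAffineSpan _) (sym (⊕-identityʳ c₀)) (inAffineSpan-∈ (here refl)) }
  ; covers      = λ ()
  }

extendFrame : {C L : List (Point n)} {c : Point n} → c ∈ C → Frame C L → Frame C (c ∷ L)
extendFrame {C = C} {L} {c} c∈C fr = extend (any? (λ x → ψ x ≟P c) (allPoints dim))
  where
  open Frame fr

  extend : Dec (Any (λ x → ψ x ≡ c) (allPoints dim)) → Frame C (c ∷ L)
  extend (yes c∈image) = record
    { dim = dim ; origin = origin ; directions = directions ; independent = independent
    ; basis↦C = basis↦C ; image⊆span = image⊆span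
    ; covers = λ { (here refl) → satisfied c∈image ; (there c′∈) → covers c′∈ }
    }
  extend (no c∉image) = record
    { dim         = suc dim
    ; origin      = origin
    ; directions  = directions′
    ; independent = independent′
    ; basis↦C     = basis↦C′
    ; image⊆span  = image⊆span′
    ; covers      = covers′
    }
    where
    directions′ = (origin ⊕ c) ∷ directions
    ψ′ = affineMap origin directions′

    ψ′-e₁ : ψ′ (true ∷ 𝟎) ≡ c
    ψ′-e₁ = begin
      origin ⊕ ((origin ⊕ c) ⊕ combination directions 𝟎)
        ≡⟨ cong (λ z → origin ⊕ ((origin ⊕ c) ⊕ z)) (combination-𝟎 directions) ⟩
      origin ⊕ ((origin ⊕ c) ⊕ 𝟎)
        ≡⟨ cong (origin ⊕_) (⊕-identityʳ (origin ⊕ c)) ⟩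
      origin ⊕ (origin ⊕ c)
        ≡⟨ ⊕-cancelˡ origin c ⟩
      c ∎
      where open ≡-Reasoning

    independent′ : Independent directions′
    independent′ (false ∷ x) h = cong (false ∷_) (independent x h)
    independent′ (true ∷ x)  h = contradiction (lose (∈-allPoints x) (sym c≡ψx)) c∉image
      where
      c≡ψx : c ≡ ψ x
      c≡ψx = trans (sym (⊕-cancelˡ origin c)) (cong (origin ⊕_) (⊕≡𝟎⇒≡ h))

    basis↦C′ : ∀ {x} → x ∈ basis (suc dim) → ψ′ x ∈ C
    basis↦C′ (here refl)         = basis↦C (here refl)
    basis↦C′ (there (here refl)) = subst (_∈ C) (sym ψ′-e₁) c∈C
    basis↦C′ (there (there x∈)) with ∈-map⁻ (false ∷_) x∈
    ... | _ , u∈ , refl = basis↦C (there u∈)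

    -- ψ′ (true ∷ x) is c + origin + ψ x, a sum of three points of the affine span.
    image⊆span′ : ∀ x → InAffineSpan C (ψ′ x)
    image⊆span′ (false ∷ x) = image⊆span x
    image⊆span′ (true ∷ x)  = subst (InAffineSpan C) ψ′≡
      (inAffineSpan-sum₃ (inAffineSpan-∈ c∈C) (inAffineSpan-∈ origin∈C) (image⊆span x))
      where
      w = combination directions x
      ψ′≡ : c ⊕ (origin ⊕ (origin ⊕ w)) ≡ origin ⊕ ((origin ⊕ c) ⊕ w)
      ψ′≡ = begin
        c ⊕ (origin ⊕ (origin ⊕ w))  ≡⟨ cong (c ⊕_) (⊕-cancelˡ origin w) ⟩
        c ⊕ w                        ≡⟨ ⊕-cancelˡ origin (c ⊕ w) ⟨
        origin ⊕ (origin ⊕ (c ⊕ w))  ≡⟨ cong (origin ⊕_) (⊕-assoc origin c w) ⟨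
        origin ⊕ ((origin ⊕ c) ⊕ w)  ∎
        where open ≡-Reasoning

    covers′ : ∀ {c′} → c′ ∈ c ∷ L → ∃ λ x → ψ′ x ≡ c′
    covers′ (here refl) = (true ∷ 𝟎) , ψ′-e₁
    covers′ (there c′∈) with covers c′∈
    ... | x , ψx≡ = (false ∷ x) , ψx≡

frameOn : {C : List (Point n)} (L : List (Point n)) → L ⊆ C → Frame C [] → Frame C L
frameOn []      _   fr = fr
frameOn (c ∷ L) L⊆C fr = extendFrame (L⊆C (here refl)) (frameOn L (L⊆C ∘ there) fr)

frame : (c₀ : Point n) (C : List (Point n)) → Frame (c₀ ∷ C) (c₀ ∷ C)
frame c₀ C = frameOn (c₀ ∷ C) id initialFrame

module FrameProperties {C : List (Point n)} (fr : Frame C C) where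
  open Frame fr

  ψ-injective : Injective _≡_ _≡_ ψ
  ψ-injective = affineMap-injective origin directions independent

  image-unique : Unique (map ψ (allPoints dim))
  image-unique = Unique.map⁺ ψ-injective (allPoints-unique dim)

  length-image : length (map ψ (allPoints dim)) ≡ 2 ^ dim
  length-image = trans (length-map ψ (allPoints dim)) (length-allPoints dim)

  dim≤n : dim ≤ n
  dim≤n = 2^m≤2^n⇒m≤n (begin
    2 ^ dim                         ≡⟨ length-image ⟨
    length (map ψ (allPoints dim))  ≤⟨ Unique-⊆⇒length≤ image-unique (λ {y} _ → ∈-allPoints y) ⟩
    length (allPoints n)            ≡⟨ length-allPoints n ⟩
    2 ^ n                           ∎)
    where open ≤-Reasoning

  ∈aff⇒image : {y : Point n} → y ∈ aff C → ∃ λ x → ψ x ≡ y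
  ∈aff⇒image y∈ with ∈-map⁻ sumP y∈
  ... | T , T∈ , refl with ∈-filter⁻ odd? {xs = sublists C} T∈
  ...   | T∈sublists , odd with sumP-images origin directions T (covers ∘ sublists-⊆ C T∈sublists)
  ...     | x , sumT≡ = x , sym (subst (λ b → sumP T ≡ (if b then ψ x else combination directions x)) odd sumT≡)

  affCard≡2^dim : affCard C ≡ 2 ^ dim
  affCard≡2^dim = trans (Unique-⊆-length≡ (Unique.filter⁺ inAff? (allPoints-unique n)) image-unique aff⊆image image⊆aff)
                        length-image
    where
    inAff? : (x : Point n) → Dec (x ∈ aff C)
    inAff? x = any? (x ≟P_) (aff C)
    aff⊆image : filter inAff? (allPoints n) ⊆ map ψ (allPoints dim)
    aff⊆image y∈ with ∈aff⇒image (proj₂ (∈-filter⁻ inAff? {xs = allPoints n} y∈))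
    ... | x , refl = ∈-map⁺ ψ (∈-allPoints x)
    image⊆aff : map ψ (allPoints dim) ⊆ filter inAff? (allPoints n)
    image⊆aff y∈ with ∈-map⁻ ψ y∈
    ... | x , _ , refl = ∈-filter⁺ inAff? (∈-allPoints (ψ x)) (inAffineSpan⇒∈aff (image⊆span x))

  C′ : List (Point dim)
  C′ = filter (λ x → ψ x ∈? C) (allPoints dim)

  ∈C′⁺ : {x : Point dim} → ψ x ∈ C → x ∈ C′
  ∈C′⁺ {x} ψx∈ = ∈-filter⁺ (λ x → ψ x ∈? C) (∈-allPoints x) ψx∈

  ∈C′⁻ : {x : Point dim} → x ∈ C′ → ψ x ∈ C
  ∈C′⁻ x∈ = proj₂ (∈-filter⁻ (λ x → ψ x ∈? C) {xs = allPoints dim} x∈)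

  C′-unique : Unique C′
  C′-unique = Unique.filter⁺ (λ x → ψ x ∈? C) (allPoints-unique dim)

  C↤C′ : ∀ {c} → c ∈ C → ∃ λ x → x ∈ C′ × c ≡ ψ x
  C↤C′ c∈ with covers c∈
  ... | x , refl = x , ∈C′⁺ c∈ , refl

  length-C′ : Unique C → length C ≡ length C′
  length-C′ uniqueC =
    trans (Unique-⊆-length≡ uniqueC (Unique.map⁺ ψ-injective C′-unique) C⊆image image⊆C) (length-map ψ C′)
    where
    C⊆image : C ⊆ map ψ C′
    C⊆image c∈ with C↤C′ c∈
    ... | x , x∈ , refl = ∈-map⁺ ψ x∈
    image⊆C : map ψ C′ ⊆ C
    image⊆C y∈ with ∈-map⁻ ψ y∈
    ... | x , x∈ , refl = ∈C′⁻ x∈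

  framedCap-C′ : IsCap C → FramedCap C′
  framedCap-C′ (_ , quadFree) =
    (C′-unique , quadFree ∘ HasQuad-map⁺ ψ ψ-injective (affineMap-preservesQuads origin directions) ∈C′⁻) ,
    ∈C′⁺ ∘ basis↦C

  extendable⇒incomplete : Extendable C′ → ¬ IsCompleteCap C
  extendable⇒incomplete (x , x-unblocked) (capC@(uniqueC , _) , maximal) = ψx∉C (All.head (maximal E E-cap E⊆aff C⊆E))
    where
    E = ψ x ∷ C
    ψx∉C : ψ x ∉ C
    ψx∉C = x-unblocked ∘ inj₁ ∘ ∈C′⁺
    E↤x∷C′ : ∀ {e} → e ∈ E → ∃ λ a → a ∈ x ∷ C′ × e ≡ ψ a
    E↤x∷C′ (here refl) = x , here refl , refl
    E↤x∷C′ (there c∈) with C↤C′ c∈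
    ... | a , a∈ , c≡ = a , there a∈ , c≡
    E-cap : IsCap E
    E-cap = (¬Any⇒All¬ C ψx∉C ∷ uniqueC) ,
            proj₂ (∷-isCap (proj₁ (framedCap-C′ capC)) x-unblocked) ∘
            HasQuad-map⁻ ψ (affineMap-reflectsQuads origin directions independent) E↤x∷C′
    E⊆aff : All (_∈ aff C) E
    E⊆aff = inAffineSpan⇒∈aff (image⊆span x) ∷ All.tabulate (inAffineSpan⇒∈aff ∘ inAffineSpan-∈)
    C⊆E : All (_∈ E) C
    C⊆E = All.tabulate there

  complete⇒length≡ : {m : ℕ} → IsCompleteCap C → CapBound dim m → ExtendableBelow dim m → length C ≡ m
  complete⇒length≡ complete@(capC , _) bound extendable =
    trans (length-C′ (proj₁ capC))
          (≤-antisym (bound framed) (≮⇒≥ λ <m → extendable⇒incomplete (extendable framed <m) complete))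
    where
    framed = framedCap-C′ capC

-- Z_2^7

check12 : State n → Bool
check12 s = (length (chosen s) ≤ᵇ 12) ∧ (if length (chosen s) <ᵇ 12 then notFull (blocked s) else true)

check12⇒≤12 : {s : State n} → check12 s ≡ true → length (chosen s) ≤ 12
check12⇒≤12 {s = s} h = ≤ᵇ⇒≤ (length (chosen s)) 12 (Equivalence.from T-≡ (proj₁ (∧≡true _ h)))

check12⇒notFull : {s : State n} → check12 s ≡ true → length (chosen s) < 12 → notFull (blocked s) ≡ true
check12⇒notFull {s = s} h <12 =
  subst (λ b → (if b then notFull (blocked s) else true) ≡ true) (Equivalence.to T-≡ (<⇒<ᵇ <12)) (proj₂ (∧≡true _ h))

-- Opaque, so that checking the uses below never unfolds the search; the explicit {7}
-- keeps Agda from normalising the search while inferring the dimension.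
opaque
  search7 : DepthFirst.allExtensionsOk check12 (root 7) (allPoints 7) ≡ true
  search7 = refl

  framedCap7-search : {D : List (Point 7)} → FramedCap D →
                      ∃ λ s → check12 s ≡ true × Valid s × chosen s ⊆ D × D ⊆ chosen s
  framedCap7-search (cap , basis⊆D) = search-complete {7} check12 search7 cap basis⊆D

capBound7 : CapBound 7 12
capBound7 framed@(cap , _) with framedCap7-search framed
... | s , ok , _ , _ , D⊆s = ≤-trans (Unique-⊆⇒length≤ (proj₁ cap) D⊆s) (check12⇒≤12 {s = s} ok)

extendableBelow7 : ExtendableBelow 7 12
extendableBelow7 framed <12 with framedCap7-search framed
... | s , ok , v , s⊆D , D⊆s with notFull⇒nonMember (blocked s) (check12⇒notFull {s = s} ok chosen<12)
  where chosen<12 = ≤-<-trans (Unique-⊆⇒length≤ (chosen-unique v) s⊆D) <12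
...   | x , x∉blocked = x , valid⇒¬Blocked v x∉blocked ∘ Blocked-mono D⊆s

cap12 : List (Point 7)
cap12 = basis 7 ++
  (true  ∷ true  ∷ true  ∷ true  ∷ false ∷ false ∷ false ∷ []) ∷
  (true  ∷ true  ∷ false ∷ false ∷ true  ∷ true  ∷ false ∷ []) ∷
  (true  ∷ false ∷ true  ∷ false ∷ true  ∷ false ∷ true  ∷ []) ∷
  (false ∷ true  ∷ false ∷ true  ∷ false ∷ true  ∷ true  ∷ []) ∷ []

cap12-isCap : IsCap cap12
cap12-isCap = toWitness {a? = UniqueDec.unique? _≟P_ cap12} _ ,
  proj₂ (admissible⇒isCap cap12 valid-empty isCap-[] refl) ∘
  HasQuad-mono (λ x∈ → ∈-chosen-addPoints⁺ cap12 {emptyState 7} (inj₁ x∈))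

cap-≤12 : (C : List (Point 7)) → IsCap C → length C ≤ 12
cap-≤12 []       _   = z≤n
cap-≤12 (c₀ ∷ C) cap = begin
  length (c₀ ∷ C)  ≡⟨ length-C′ (proj₁ cap) ⟩
  length C′        ≤⟨ capBound-≤′ (≤⇒≤′ dim≤n) capBound7 (framedCap-C′ cap) ⟩
  12               ∎
  where
  open FrameProperties (frame c₀ C)
  open ≤-Reasoning

affCard-[] : (n : ℕ) → affCard {n} [] ≡ 0
affCard-[] n = cong length (filter-none (λ x → any? (x ≟P_) (aff {n} [])) {xs = allPoints n} (All.tabulate λ _ ()))

completeCap-≡12 : (n : ℕ) (C : List (Point n)) → IsCompleteCap C → HasDim C 7 → length C ≡ 12
completeCap-≡12 n []       _        dim7 = contradiction (trans (sym (affCard-[] n)) dim7) λ ()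
completeCap-≡12 n (c₀ ∷ C) complete dim7 =
  complete⇒length≡ complete (subst (λ k → CapBound k 12) (sym dim≡7) capBound7)
                            (subst (λ k → ExtendableBelow k 12) (sym dim≡7) extendableBelow7)
  where
  open FrameProperties (frame c₀ C)
  dim≡7 : Frame.dim (frame c₀ C) ≡ 7
  dim≡7 = 2^m≡2^n⇒m≡n (trans (sym affCard≡2^dim) dim7)

corollary8p3 :
    ((Σ (List (Point 7)) λ C → IsCap C × length C ≡ 12)
      × ((C : List (Point 7)) → IsCap C → length C ≤ 12))
    × ((n : ℕ) (C : List (Point n)) → IsCompleteCap C → HasDim C 7 → length C ≡ 12)
corollary8p3 = ((cap12 , cap12-isCap , refl) , cap-≤12) , completeCap-≡12
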